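{- Let $\lesssim$ be a plausible preorder on $\mathcal{T}$ and $E(\cdot|\cdot)$ the conditional expectation naturally induced by it; write $P(C|D)=E(C|D)$. Let $X$ be a random quantity and $C,D$ events. Suppose $P(C|D)=0$ and there is a real number $p$ such that $1\lesssim_D p\,(X.C)$. Then $p\neq0$ and $E(X|C.D)=\frac{+\infty}{p}$; that is, $E(X|C.D)=+\infty$ if $p>0$ and $E(X|C.D)=-\infty$ if $p<0$.
   Context: Random quantities: $\mathcal{T}$ is a unital associative commutative algebra over $\mathbb{R}$; reals $r$ are identified with $r\mathbf{1}$; products are written $X.Y$. Events: idempotents $A$ ($A.A=A$). Plausible preorder: a relation $\lesssim$ on $\mathcal{T}$ with (i) $0\lesssim A$ for every event $A$; (ii) $0\lesssim X$ and $0\lesssim Y$ imply $0\lesssim X+Y$; (iii) $0\lesssim X$ and real $q\ge0$ imply $0\lesssim qX$; (iv) $X\lesssim Y$ iff $0\lesssim Y-X$. Strict part: $X\lnsim Y$ iff $X\lesssim Y$ and not $Y\lesssim X$. Conditional preorder: $X\lesssim_C Y$ iff $X.C\lesssim Y.C$; strict part $\lnsim_C$. Expectation induced by a plausible preorder: $E(X)$ is the real $x$ if $-\epsilon\lnsim X-x\lnsim\epsilon$ for all reals $\epsilon>0$; it is $+\infty$ if $y\lnsim X$ for all reals $y$; it is $-\infty$ if $X\lnsim y$ for all reals $y$; it is undefined otherwise. Conditional expectation: $E(X|C)$ is the expectation induced by $\lesssim_C$. Conditional probability: $P(C|D)=E(C|D)$. -}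

module Defs where

open import Level using (0ℓ)
open import Algebra.Bundles using (CommutativeRing)
open import Algebra.Morphism.Structures using (module RingMorphisms)
open import Relation.Binary.Structures using (IsStrictTotalOrder)
open import Relation.Nullary using (¬_)
open import Data.Product using (Σ; ∃; _×_; _,_)
open import Data.Sum using (_⊎_)

-- The real numbers, axiomatised as a Dedekind-complete ordered field.
-- (agda-stdlib has no ℝ; any model of this record is isomorphic to ℝ.)

record RealField : Set₁ where
  field
    realRing : CommutativeRing 0ℓ 0ℓ
  open CommutativeRing realRing public renaming (Carrier to ℝ)
  infix 4 _<_ _≤_
  field
    _<_ : ℝ → ℝ → Set
    <-isStrictTotalOrder : IsStrictTotalOrder _≈_ _<_
    0≉1 : ¬ (0# ≈ 1#)
    inv : (x : ℝ) → ¬ (x ≈ 0#) → ℝ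
    inv-correct : ∀ x (nz : ¬ (x ≈ 0#)) → x * inv x nz ≈ 1#
    +-mono-< : ∀ {x y} z → x < y → x + z < y + z
    *-pos : ∀ {x y} → 0# < x → 0# < y → 0# < x * y

  _≤_ : ℝ → ℝ → Set
  x ≤ y = x < y ⊎ x ≈ y

  field
    sup : (S : ℝ → Set) → ∃ S → (∃ λ b → ∀ x → S x → x ≤ b) →
          ∃ λ s → (∀ x → S x → x ≤ s) × (∀ b → (∀ x → S x → x ≤ b) → s ≤ b)

-- Random quantities: a unital associative commutative ℝ-algebra 𝒯,
-- presented as a commutative ring together with the structure map
-- ι : ℝ → 𝒯 (r ↦ r𝟏), a unital ring homomorphism.  Scalar
-- multiplication q X is ι q * X; reals r are identified with ι r.

record RAlgebra (R : RealField) : Set₁ where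
  module ℝ = RealField R
  field
    algRing : CommutativeRing 0ℓ 0ℓ
  open CommutativeRing algRing public renaming (Carrier to 𝒯)
  field
    ι : ℝ.ℝ → 𝒯
    ι-isRingHomomorphism :
      RingMorphisms.IsRingHomomorphism (CommutativeRing.rawRing ℝ.realRing)
                                       (CommutativeRing.rawRing algRing) ι

module _ {R : RealField} (A : RAlgebra R) where
  open RealField R using (ℝ) renaming (_<_ to _<ℝ_; _≤_ to _≤ℝ_; 0# to 0ℝ)
  open RAlgebra A

  IsEvent : 𝒯 → Set
  IsEvent C = C * C ≈ C

  -- axioms (i)-(iv) of a plausible preorder for a relation _≲_ on 𝒯
  -- (the relation is also required to respect the setoid equality of 𝒯,
  -- which is automatic in the paper where equality is literal)
  record IsPlausiblePreorder (_≲_ : 𝒯 → 𝒯 → Set) : Set where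
    field
      ≲-resp-≈ : ∀ {X X′ Y Y′} → X ≈ X′ → Y ≈ Y′ → X ≲ Y → X′ ≲ Y′
      event-nonneg : ∀ C → IsEvent C → 0# ≲ C
      nonneg-+ : ∀ {X Y} → 0# ≲ X → 0# ≲ Y → 0# ≲ (X + Y)
      nonneg-scale : ∀ {X} (q : ℝ) → 0ℝ ≤ℝ q → 0# ≲ X → 0# ≲ (ι q * X)
      ≲⇒diff : ∀ {X Y} → X ≲ Y → 0# ≲ (Y - X)
      diff⇒≲ : ∀ {X Y} → 0# ≲ (Y - X) → X ≲ Y

  Strict : (𝒯 → 𝒯 → Set) → 𝒯 → 𝒯 → Set
  Strict _≲_ X Y = X ≲ Y × ¬ (Y ≲ X)

  Cond : (𝒯 → 𝒯 → Set) → 𝒯 → 𝒯 → 𝒯 → Set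
  Cond _≲_ C X Y = (X * C) ≲ (Y * C)

  data ExtReal : Set where
    fin : ℝ → ExtReal
    +∞ : ExtReal
    -∞ : ExtReal

  ExpectationIs : (𝒯 → 𝒯 → Set) → 𝒯 → ExtReal → Set
  ExpectationIs _≲_ X (fin x) =
    ∀ (ε : ℝ) → 0ℝ <ℝ ε →
      Strict _≲_ (ι (RealField.-_ R ε)) (X - ι x) × Strict _≲_ (X - ι x) (ι ε)
  ExpectationIs _≲_ X +∞ = ∀ (y : ℝ) → Strict _≲_ (ι y) X
  ExpectationIs _≲_ X -∞ = ∀ (y : ℝ) → Strict _≲_ X (ι y)

  CondExpectationIs : (𝒯 → 𝒯 → Set) → 𝒯 → 𝒯 → ExtReal → Set
  CondExpectationIs _≲_ X C v = ExpectationIs (Cond _≲_ C) X v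

  CondProbIs : (𝒯 → 𝒯 → Set) → 𝒯 → 𝒯 → ExtReal → Set
  CondProbIs _≲_ C D v = CondExpectationIs _≲_ C D v

-- Write E = C.D.  P(C|D) = 0 says E ≲ εD for every ε > 0 but never εD ≲ E; hence D is
-- not dominated by any real multiple kE (scale by 1/k when k > 0, and kE ≲ 0 otherwise).
-- The hypothesis D ≲ p(X.E) therefore forces p ≠ 0.  For p > 0 it gives yE ≲ D/p ≲ X.E
-- for every real y, while X.E ≲ yE would yield D ≲ (py)E.  The case p < 0 is the case
-- p > 0 for -X and -p, since negation reverses the preorder.
module Submission where

open import Defs
open import Data.Product using (_×_)
open import Relation.Nullary using (¬_)
open RealField using (ℝ)
open RAlgebra using (𝒯; ι)
open import Algebra.Bundles using (module CommutativeRing; Ring)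

open import Data.Product using (_,_; proj₁; proj₂)
open import Data.Sum using (_⊎_; inj₁; inj₂)
open import Relation.Nullary using (contradiction)
open import Relation.Binary.Structures using (module IsStrictTotalOrder)
open import Relation.Binary.Definitions using (tri<; tri≈; tri>)
open import Algebra.Morphism.Structures using (module RingMorphisms)
import Algebra.Properties.Ring as RingProperties
import Algebra.Properties.CommutativeSemigroup as CommutativeSemigroupProperties
import Relation.Binary.Reasoning.Setoid as SetoidReasoning

module RingNegation {c ℓ} (R : Ring c ℓ) where
  open Ring R
  open RingProperties R

  -x*-y≈x*y : ∀ x y → - x * - y ≈ x * y
  -x*-y≈x*y x y = begin
    - x * - y       ≈⟨ -‿distribˡ-* x (- y) ⟨
    - (x * - y)     ≈⟨ -‿cong (-‿distribʳ-* x y) ⟨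
    - (- (x * y))   ≈⟨ -‿involutive (x * y) ⟩
    x * y           ∎
    where open SetoidReasoning setoid

module OrderedFieldProperties (R : RealField) where
  open RealField R
  open RingProperties ring using (-‿involutive; -0#≈0#; -‿distribʳ-*; -1*x≈-x)
  module < = IsStrictTotalOrder <-isStrictTotalOrder

  x<0⇒0<-x : ∀ {x} → x < 0# → 0# < - x
  x<0⇒0<-x {x} x<0 =
    <.<-respʳ-≈ (+-identityˡ (- x)) (<.<-respˡ-≈ (-‿inverseʳ x) (+-mono-< (- x) x<0))

  0<x⇒-x<0 : ∀ {x} → 0# < x → - x < 0#
  0<x⇒-x<0 {x} 0<x =
    <.<-respʳ-≈ (-‿inverseʳ x) (<.<-respˡ-≈ (+-identityˡ (- x)) (+-mono-< (- x) 0<x))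

  x≤0⇒0≤-x : ∀ {x} → x ≤ 0# → 0# ≤ - x
  x≤0⇒0≤-x (inj₁ x<0) = inj₁ (x<0⇒0<-x x<0)
  x≤0⇒0≤-x (inj₂ x≈0) = inj₂ (trans (sym -0#≈0#) (-‿cong (sym x≈0)))

  0<x⊎x≤0 : ∀ x → 0# < x ⊎ x ≤ 0#
  0<x⊎x≤0 x with <.compare 0# x
  ... | tri< 0<x _ _ = inj₁ 0<x
  ... | tri≈ _ 0≈x _ = inj₂ (inj₂ (sym 0≈x))
  ... | tri> _ _ x<0 = inj₂ (inj₁ x<0)

  0<x⇒x≉0 : ∀ {x} → 0# < x → ¬ (x ≈ 0#)
  0<x⇒x≉0 0<x x≈0 = <.irrefl (sym x≈0) 0<x

  -- If 1 < 0 then 0 < (-1)(-1) = 1.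
  0<1 : 0# < 1#
  0<1 with <.compare 0# 1#
  ... | tri< 0<1 _ _ = 0<1
  ... | tri≈ _ 0≈1 _ = contradiction 0≈1 0≉1
  ... | tri> _ _ 1<0 = contradiction
        (<.<-respʳ-≈ (trans (-1*x≈-x (- 1#)) (-‿involutive 1#))
                     (*-pos (x<0⇒0<-x 1<0) (x<0⇒0<-x 1<0)))
        (<.asym 1<0)

  inv-correctˡ : ∀ x (x≉0 : ¬ (x ≈ 0#)) → inv x x≉0 * x ≈ 1#
  inv-correctˡ x x≉0 = trans (*-comm (inv x x≉0) x) (inv-correct x x≉0)

  inv-pos : ∀ {x} (0<x : 0# < x) → 0# < inv x (0<x⇒x≉0 0<x)
  inv-pos {x} 0<x with <.compare 0# (inv x (0<x⇒x≉0 0<x))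
  ... | tri< 0<x⁻¹ _ _ = 0<x⁻¹
  ... | tri≈ _ 0≈x⁻¹ _ = contradiction
        (trans (sym (zeroʳ x)) (trans (*-cong refl 0≈x⁻¹) (inv-correct x _))) 0≉1
  ... | tri> _ _ x⁻¹<0 = contradiction
        (<.<-respʳ-≈ (trans (sym (-‿distribʳ-* x _)) (-‿cong (inv-correct x _)))
                     (*-pos 0<x (x<0⇒0<-x x⁻¹<0)))
        (<.asym (0<x⇒-x<0 0<1))

  x*[y*x⁻¹]≈y : ∀ x y (x≉0 : ¬ (x ≈ 0#)) → x * (y * inv x x≉0) ≈ y
  x*[y*x⁻¹]≈y x y x≉0 = begin
    x * (y * inv x x≉0)   ≈⟨ *-cong refl (*-comm y (inv x x≉0)) ⟩
    x * (inv x x≉0 * y)   ≈⟨ *-assoc x (inv x x≉0) y ⟨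
    (x * inv x x≉0) * y   ≈⟨ *-cong (inv-correct x x≉0) refl ⟩
    1# * y                ≈⟨ *-identityˡ y ⟩
    y                     ∎
    where open SetoidReasoning setoid

module PlausiblePreorderProperties {R : RealField} (A : RAlgebra R)
       {_≲_ : 𝒯 A → 𝒯 A → Set} (pp : IsPlausiblePreorder A _≲_) where
  open RAlgebra A hiding (𝒯; ι)
  open IsPlausiblePreorder pp
  open RingProperties ring using (-‿involutive; -0#≈0#; -‿distribˡ-*; x[y-z]≈xy-xz; ⁻¹-anti-homo‿-; -‿+-comm)
  open RingNegation ring using (-x*-y≈x*y)
  open OrderedFieldProperties R using (x≤0⇒0≤-x)
  open SetoidReasoning setoid

  private
    module H = RingMorphisms.IsRingHomomorphism ι-isRingHomomorphism
    ι′ : ℝ R → 𝒯 A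
    ι′ = ι A

  ι-cong : ∀ {a b} Z → a ℝ.≈ b → ι′ a * Z ≈ ι′ b * Z
  ι-cong Z a≈b = *-cong (H.⟦⟧-cong a≈b) refl

  ι-assoc : ∀ a b Z → ι′ a * (ι′ b * Z) ≈ ι′ (a ℝ.* b) * Z
  ι-assoc a b Z = trans (sym (*-assoc (ι′ a) (ι′ b) Z)) (*-cong (sym (H.*-homo a b)) refl)

  ι-identity : ∀ Z → ι′ ℝ.1# * Z ≈ Z
  ι-identity Z = trans (*-cong H.1#-homo refl) (*-identityˡ Z)

  ι-zero : ∀ Z → ι′ ℝ.0# * Z ≈ 0#
  ι-zero Z = trans (*-cong H.0#-homo refl) (zeroˡ Z)

  x-ι0≈x : ∀ Z → Z - ι′ ℝ.0# ≈ Z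
  x-ι0≈x Z = trans (+-cong refl (trans (-‿cong H.0#-homo) -0#≈0#)) (+-identityʳ Z)

  ι-neg : ∀ a Z → ι′ (ℝ.- a) * Z ≈ - (ι′ a * Z)
  ι-neg a Z = trans (*-cong (H.-‿homo a) refl) (sym (-‿distribˡ-* (ι′ a) Z))

  ι-neg*neg : ∀ a X Z → ι′ (ℝ.- a) * (- X * Z) ≈ ι′ a * (X * Z)
  ι-neg*neg a X Z = begin
    ι′ (ℝ.- a) * (- X * Z)   ≈⟨ *-cong (H.-‿homo a) (sym (-‿distribˡ-* X Z)) ⟩
    - ι′ a * - (X * Z)       ≈⟨ -x*-y≈x*y (ι′ a) (X * Z) ⟩
    ι′ a * (X * Z)           ∎

  ≈⇒≲ : ∀ {X Y} → X ≈ Y → X ≲ Y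
  ≈⇒≲ {X} {Y} X≈Y = diff⇒≲ (≲-resp-≈ refl Y-Y≈Y-X (event-nonneg 0# (zeroˡ 0#)))
    where
    Y-Y≈Y-X : 0# ≈ Y - X
    Y-Y≈Y-X = sym (trans (+-cong refl (-‿cong X≈Y)) (-‿inverseʳ Y))

  ≲-trans : ∀ {X Y Z} → X ≲ Y → Y ≲ Z → X ≲ Z
  ≲-trans {X} {Y} {Z} X≲Y Y≲Z =
    diff⇒≲ (≲-resp-≈ refl telescope (nonneg-+ (≲⇒diff Y≲Z) (≲⇒diff X≲Y)))
    where
    telescope : (Z - Y) + (Y - X) ≈ Z - X
    telescope = begin
      (Z - Y) + (Y - X)    ≈⟨ +-assoc Z (- Y) (Y - X) ⟩
      Z + (- Y + (Y - X))  ≈⟨ +-cong refl (+-assoc (- Y) Y (- X)) ⟨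
      Z + ((- Y + Y) - X)  ≈⟨ +-cong refl (+-cong (-‿inverseˡ Y) refl) ⟩
      Z + (0# - X)         ≈⟨ +-cong refl (+-identityˡ (- X)) ⟩
      Z - X                ∎

  neg-antimono-≲ : ∀ {X Y} → X ≲ Y → (- Y) ≲ (- X)
  neg-antimono-≲ {X} {Y} X≲Y = diff⇒≲ (≲-resp-≈ refl Y-X≈-X--Y (≲⇒diff X≲Y))
    where
    Y-X≈-X--Y : Y - X ≈ - X - - Y
    Y-X≈-X--Y = sym (trans (-‿+-comm X (- Y)) (⁻¹-anti-homo‿- X Y))

  ι-scale-≲ : ∀ {Y Z} a b → ℝ.0# ℝ.≤ a → Y ≲ (ι′ b * Z) → (ι′ a * Y) ≲ (ι′ (a ℝ.* b) * Z)
  ι-scale-≲ {Y} {Z} a b 0≤a Y≲bZ = diff⇒≲ (≲-resp-≈ refl scale-diff (nonneg-scale a 0≤a (≲⇒diff Y≲bZ)))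
    where
    scale-diff : ι′ a * (ι′ b * Z - Y) ≈ ι′ (a ℝ.* b) * Z - ι′ a * Y
    scale-diff = trans (x[y-z]≈xy-xz (ι′ a) (ι′ b * Z) Y) (+-cong (ι-assoc a b Z) refl)

  nonpos-scale-≲0 : ∀ {Z} k → k ℝ.≤ ℝ.0# → 0# ≲ Z → (ι′ k * Z) ≲ 0#
  nonpos-scale-≲0 {Z} k k≤0 0≲Z =
    ≲-resp-≈ negate -0#≈0# (neg-antimono-≲ (nonneg-scale (ℝ.- k) (x≤0⇒0≤-x k≤0) 0≲Z))
    where
    negate : - (ι′ (ℝ.- k) * Z) ≈ ι′ k * Z
    negate = trans (-‿cong (ι-neg k Z)) (-‿involutive (ι′ k * Z))

  Strict-neg : ∀ {X Y} → Strict A _≲_ (- X) (- Y) → Strict A _≲_ Y X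
  Strict-neg {X} {Y} (-X≲-Y , -Y≴-X) =
    ≲-resp-≈ (-‿involutive Y) (-‿involutive X) (neg-antimono-≲ -X≲-Y) ,
    λ X≲Y → -Y≴-X (neg-antimono-≲ X≲Y)

  neg-+∞⇒-∞ : ∀ {X E} → CondExpectationIs A _≲_ (- X) E +∞ → CondExpectationIs A _≲_ X E -∞
  neg-+∞⇒-∞ {X} {E} E[-X]≡+∞ y with E[-X]≡+∞ (ℝ.- y)
  ... | (-yE≲-XE , -XE≴-yE) = Strict-neg
        ( ≲-resp-≈ (ι-neg y E) (sym (-‿distribˡ-* X E)) -yE≲-XE
        , λ -XE≲-yE → -XE≴-yE (≲-resp-≈ (-‿distribˡ-* X E) (sym (ι-neg y E)) -XE≲-yE))

module NullConditionalProbability {R : RealField} (A : RAlgebra R)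
       {_≲_ : 𝒯 A → 𝒯 A → Set} (pp : IsPlausiblePreorder A _≲_)
       {C D : 𝒯 A} (evC : IsEvent A C) (evD : IsEvent A D)
       (P[C|D]≡0 : CondProbIs A _≲_ C D (fin (RealField.0# R))) where
  open RAlgebra A hiding (𝒯; ι)
  open IsPlausiblePreorder pp
  open PlausiblePreorderProperties A pp
  open OrderedFieldProperties R using (0<1; 0<x⊎x≤0; 0<x⇒x≉0; inv-pos; inv-correctˡ; x*[y*x⁻¹]≈y)
  open CommutativeSemigroupProperties *-commutativeSemigroup using (interchange)

  private
    ι′ : ℝ R → 𝒯 A
    ι′ = ι A

  [C-0]D≈CD : (C - ι′ ℝ.0#) * D ≈ C * D
  [C-0]D≈CD = *-cong (x-ι0≈x C) refl

  CD≲εD : ∀ ε → ℝ.0# ℝ.< ε → (C * D) ≲ (ι′ ε * D)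
  CD≲εD ε 0<ε = ≲-resp-≈ [C-0]D≈CD refl (proj₁ (proj₂ (P[C|D]≡0 ε 0<ε)))

  εD≴CD : ∀ ε → ℝ.0# ℝ.< ε → ¬ ((ι′ ε * D) ≲ (C * D))
  εD≴CD ε 0<ε εD≲CD = proj₂ (proj₂ (P[C|D]≡0 ε 0<ε)) (≲-resp-≈ refl (sym [C-0]D≈CD) εD≲CD)

  0≲CD : 0# ≲ (C * D)
  0≲CD = event-nonneg (C * D) (trans (interchange C D C D) (*-cong evC evD))

  D≴0 : ¬ (D ≲ 0#)
  D≴0 D≲0 = εD≴CD ℝ.1# 0<1 (≲-resp-≈ (sym (ι-identity D)) refl (≲-trans D≲0 0≲CD))

  D≴ι*CD : ∀ k → ¬ (D ≲ (ι′ k * (C * D)))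
  D≴ι*CD k D≲kCD with 0<x⊎x≤0 k
  ... | inj₁ 0<k = εD≴CD k⁻¹ (inv-pos 0<k)
        (≲-resp-≈ refl (trans (ι-cong (C * D) (inv-correctˡ k k≉0)) (ι-identity (C * D)))
                  (ι-scale-≲ k⁻¹ k (inj₁ (inv-pos 0<k)) D≲kCD))
    where
    k≉0 : ¬ (k ℝ.≈ ℝ.0#)
    k≉0 = 0<x⇒x≉0 0<k
    k⁻¹ : ℝ R
    k⁻¹ = ℝ.inv k k≉0
  ... | inj₂ k≤0 = D≴0 (≲-trans D≲kCD (nonpos-scale-≲0 k k≤0 0≲CD))

  ι*CD≲ι*D : ∀ y q → ℝ.0# ℝ.< q → (ι′ y * (C * D)) ≲ (ι′ q * D)
  ι*CD≲ι*D y q 0<q with 0<x⊎x≤0 y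
  ... | inj₁ 0<y = ≲-resp-≈ refl (ι-cong D (x*[y*x⁻¹]≈y y q y≉0))
                    (ι-scale-≲ y (q ℝ.* ℝ.inv y y≉0) (inj₁ 0<y)
                      (CD≲εD _ (ℝ.*-pos 0<q (inv-pos 0<y))))
    where
    y≉0 : ¬ (y ℝ.≈ ℝ.0#)
    y≉0 = 0<x⇒x≉0 0<y
  ... | inj₂ y≤0 = ≲-trans (nonpos-scale-≲0 y y≤0 0≲CD)
                    (nonneg-scale q (inj₁ 0<q) (event-nonneg D evD))

  module _ {X : 𝒯 A} (p : ℝ R) (D≲pXCD : D ≲ (ι′ p * (X * (C * D)))) where

    dominating-coefficient-≉0 : ¬ (p ℝ.≈ ℝ.0#)
    dominating-coefficient-≉0 p≈0 =
      D≴0 (≲-trans D≲pXCD (≈⇒≲ (trans (ι-cong _ p≈0) (ι-zero _))))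

    dominated-expectation-+∞ : ℝ.0# ℝ.< p → CondExpectationIs A _≲_ X (C * D) +∞
    dominated-expectation-+∞ 0<p y = ≲-trans (ι*CD≲ι*D y p⁻¹ (inv-pos 0<p)) D/p≲XCD , XCD≴yCD
      where
      p≉0 : ¬ (p ℝ.≈ ℝ.0#)
      p≉0 = 0<x⇒x≉0 0<p
      p⁻¹ : ℝ R
      p⁻¹ = ℝ.inv p p≉0

      D/p≲XCD : (ι′ p⁻¹ * D) ≲ (X * (C * D))
      D/p≲XCD = ≲-resp-≈ refl (trans (ι-cong _ (inv-correctˡ p p≉0)) (ι-identity _))
                  (ι-scale-≲ p⁻¹ p (inj₁ (inv-pos 0<p)) D≲pXCD)

      XCD≴yCD : ¬ ((X * (C * D)) ≲ (ι′ y * (C * D)))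
      XCD≴yCD XCD≲yCD = D≴ι*CD (p ℝ.* y) (≲-trans D≲pXCD (ι-scale-≲ p y (inj₁ 0<p) XCD≲yCD))

mainTheorem9 : (R : RealField) (A : RAlgebra R) →
    (_≲_ : 𝒯 A → 𝒯 A → Set) → IsPlausiblePreorder A _≲_ →
    (X C D : 𝒯 A) → IsEvent A C → IsEvent A D →
    CondProbIs A _≲_ C D (fin (RealField.0# R)) →
    (p : ℝ R) →
    Cond A _≲_ D (RAlgebra.1# A) (RAlgebra._*_ A (ι A p) (RAlgebra._*_ A X C)) →
    ¬ (RealField._≈_ R p (RealField.0# R))
      × (RealField._<_ R (RealField.0# R) p →
           CondExpectationIs A _≲_ X (RAlgebra._*_ A C D) +∞)
      × (RealField._<_ R p (RealField.0# R) →
           CondExpectationIs A _≲_ X (RAlgebra._*_ A C D) -∞)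
mainTheorem9 R A _≲_ pp X C D evC evD P[C|D]≡0 p [1≲pXC]ᴰ =
  dominating-coefficient-≉0 p D≲pXCD ,
  dominated-expectation-+∞ p D≲pXCD ,
  λ p<0 → neg-+∞⇒-∞ (dominated-expectation-+∞ (ℝ.- p) D≲-p-XCD (x<0⇒0<-x p<0))
  where
  open RAlgebra A hiding (𝒯; ι)
  open IsPlausiblePreorder pp using (≲-resp-≈)
  open PlausiblePreorderProperties A pp using (ι-neg*neg; neg-+∞⇒-∞)
  open NullConditionalProbability A pp evC evD P[C|D]≡0
  open OrderedFieldProperties R using (x<0⇒0<-x)

  D≲pXCD : D ≲ (ι A p * (X * (C * D)))
  D≲pXCD = ≲-resp-≈ (*-identityˡ D)
             (trans (*-assoc (ι A p) (X * C) D) (*-cong refl (*-assoc X C D))) [1≲pXC]ᴰ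

  D≲-p-XCD : D ≲ (ι A (ℝ.- p) * (- X * (C * D)))
  D≲-p-XCD = ≲-resp-≈ refl (sym (ι-neg*neg p X (C * D))) D≲pXCD
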